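{- For every integer $k\ge1$, every $k$-letter graph is a $k$-thin graph.
   Context: A graph $G=(\{1,\dots,n\},E)$ is a $k$-letter graph if there exist a word $w\in\{1,\dots,k\}^n$ and a set $\mathcal{D}\subseteq\{1,\dots,k\}^2$ such that for all $1\le i<j\le n$: $\{i,j\}\in E$ iff $w[i]w[j]\in\mathcal{D}$ (graphs isomorphic to such graphs are also $k$-letter graphs). A graph $G=(V,E)$ is $k$-thin if its vertices admit a linear ordering $v_1<\dots<v_n$ and a partition $V=V^1\uplus\dots\uplus V^k$ such that for all $a<b<c$ with $v_a,v_b$ in the same part and $\{v_a,v_c\}\in E$, also $\{v_b,v_c\}\in E$. -}

module Defs where

open import Data.Nat using (ℕ)
open import Data.Fin using (Fin; _<_)
open import Data.Bool using (Bool; true)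
open import Data.Product using (Σ; ∃; ∃-syntax; _×_)
open import Relation.Binary.PropositionalEquality using (_≡_)
open import Relation.Nullary using (¬_)
open import Function.Bundles using (_⤖_; _⇔_; Bijection)
open import Level using (0ℓ; suc)

record Graph (n : ℕ) : Set₁ where
  field
    Adj     : Fin n → Fin n → Set
    sym     : ∀ {x y} → Adj x y → Adj y x
    irrefl  : ∀ {x} → ¬ Adj x x

open Graph public

-- G is a k-letter graph: G is isomorphic (via a bijection σ from positions
-- {1..n} to the vertices of G) to the letter graph of a word w ∈ [k]^n and a
-- set D ⊆ [k]^2 (given by its characteristic function), i.e. for all
-- positions i < j, σ i ~ σ j iff (w i, w j) ∈ D.
IsLetterGraph : (k : ℕ) {n : ℕ} → Graph n → Set
IsLetterGraph k {n} G =
  Σ (Fin n ⤖ Fin n) λ σ →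
  Σ (Fin n → Fin k) λ w →
  Σ (Fin k → Fin k → Bool) λ D →
    ∀ (i j : Fin n) → i < j →
      Adj G (Bijection.to σ i) (Bijection.to σ j) ⇔ (D (w i) (w j) ≡ true)

-- G is k-thin: there is a linear ordering v_1 < ... < v_n of the vertices
-- (given by the bijection v from positions to vertices) and a partition of
-- the vertices into k (possibly empty) classes (given by part) such that for
-- all a < b < c with v_a, v_b in the same class and v_a ~ v_c, also v_b ~ v_c.
IsThin : (k : ℕ) {n : ℕ} → Graph n → Set
IsThin k {n} G =
  Σ (Fin n ⤖ Fin n) λ v →
  Σ (Fin n → Fin k) λ part →
    ∀ (a b c : Fin n) → a < b → b < c →
      part (Bijection.to v a) ≡ part (Bijection.to v b) →
      Adj G (Bijection.to v a) (Bijection.to v c) →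
      Adj G (Bijection.to v b) (Bijection.to v c)

{-# OPTIONS --safe #-}
module Submission where

-- Order the vertices as the positions of the word and put each vertex in the
-- class of its letter.  If positions a and b carry the same letter and lie
-- before c, then whether they are adjacent to c is decided by D on the same
-- pair of letters, so the neighbourhood condition of thinness holds even
-- without a < b.

open import Defs
open import Data.Bool using (Bool; true)
open import Data.Nat using (ℕ; _≥_)
open import Data.Fin using (Fin; _<_)
open import Data.Fin.Properties using (<-trans)
open import Data.Product using (_,_)
open import Function.Base using (_∘_)
open import Function.Bundles using (_⤖_; _⇔_; Bijection; Inverse; Equivalence)
open import Function.Properties.Bijection using (⤖⇒↔)
open import Relation.Binary.PropositionalEquality
  using (_≡_; cong; subst; module ≡-Reasoning)

module LetterGraph {k n : ℕ} (G : Graph n) (σ : Fin n ⤖ Fin n)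
  (w : Fin n → Fin k) (D : Fin k → Fin k → Bool)
  (adj⇔D : ∀ i j → i < j →
    Adj G (Bijection.to σ i) (Bijection.to σ j) ⇔ (D (w i) (w j) ≡ true))
  where

  open Bijection σ using (to; to⁻)

  sameLetter⇒sameLaterNeighbours : ∀ {a b c} → w a ≡ w b → a < c → b < c →
    Adj G (to a) (to c) → Adj G (to b) (to c)
  sameLetter⇒sameLaterNeighbours {a} {b} {c} wa≡wb a<c b<c =
    Equivalence.from (adj⇔D b c b<c)
    ∘ subst (λ x → D x (w c) ≡ true) wa≡wb
    ∘ Equivalence.to (adj⇔D a c a<c)

  letterOf : Fin n → Fin k
  letterOf = w ∘ to⁻

  letterOf-to : ∀ i → letterOf (to i) ≡ w i
  letterOf-to i = cong w (Inverse.strictlyInverseʳ (⤖⇒↔ σ) i)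

  isThin : IsThin k G
  isThin = σ , letterOf , thin
    where
    thin : ∀ a b c → a < b → b < c → letterOf (to a) ≡ letterOf (to b) →
      Adj G (to a) (to c) → Adj G (to b) (to c)
    thin a b c a<b b<c same = sameLetter⇒sameLaterNeighbours wa≡wb (<-trans a<b b<c) b<c
      where
      open ≡-Reasoning
      wa≡wb : w a ≡ w b
      wa≡wb = begin
        w a              ≡⟨ letterOf-to a ⟨
        letterOf (to a)  ≡⟨ same ⟩
        letterOf (to b)  ≡⟨ letterOf-to b ⟩
        w b              ∎

theorem15 : (k : ℕ) → k ≥ 1 → (n : ℕ) (G : Graph n) →
    IsLetterGraph k G → IsThin k G
theorem15 k _ n G (σ , w , D , adj⇔D) = LetterGraph.isThin G σ w D adj⇔D
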